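{- Let $D$ be a mixed graph whose underlying graph is bipartite, and suppose every cycle of $D$ contains an even number of digons. Then $\sigma_\gamma(D)=\sigma_\omega(D)$, where $\gamma=e^{2\pi i/3}$ and $\omega=e^{\pi i/3}$.
   Context: A mixed graph $D$ is obtained from a finite simple undirected graph $\Gamma(D)$ by replacing some edges by arcs: between any two adjacent vertices $u,v$ there is exactly one of a digon (undirected edge) $u\sim v$, an arc $u\to v$, or an arc $v\to u$. Cycles refer to $\Gamma(D)$. For $|\alpha|=1$, $H^\alpha(D)=[h_{uv}]$ has $h_{uv}=1$ if $u\sim v$, $\alpha$ if $u\to v$, $\bar\alpha$ if $v\to u$, $0$ otherwise, and $\sigma_\alpha(D)$ is its multiset of eigenvalues. -}

module Defs where

open import Data.Nat as ℕ using (ℕ; zero; suc; _≤_)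
open import Data.Integer as ℤ using (ℤ; +_; -[1+_])
open import Data.Fin using (Fin; zero; suc; punchIn; _≟_)
open import Data.List using (List; []; _∷_; length; map; foldr; filter)
open import Data.List.Relation.Unary.All using (All)
open import Data.List.Relation.Unary.Unique.Propositional using (Unique)
open import Data.List.Base using (allFin)
open import Data.Bool using (Bool)
open import Data.Product using (_×_; _,_; ∃)
open import Relation.Binary.PropositionalEquality using (_≡_; _≢_)
open import Relation.Nullary using (¬_; yes; no; Dec)

-- Eisenstein integers ℤ[ω], ω = e^{πi/3}, ω² = ω - 1.
-- An element  re + im·ω.  All entries of H^γ, H^ω lie in this subring of ℂ.

record ℤω : Set where
  constructor _+_ω
  field
    re : ℤ
    im : ℤ
open ℤω public

0w 1w : ℤω
0w = (+ 0) + (+ 0) ω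
1w = (+ 1) + (+ 0) ω

_+w_ : ℤω → ℤω → ℤω
(a + b ω) +w (c + d ω) = (a ℤ.+ c) + (b ℤ.+ d) ω

-w_ : ℤω → ℤω
-w (a + b ω) = (ℤ.- a) + (ℤ.- b) ω

-- (a+bω)(c+dω) = ac + (ad+bc)ω + bd ω² , ω² = ω - 1
_*w_ : ℤω → ℤω → ℤω
(a + b ω) *w (c + d ω) = (a ℤ.* c ℤ.- b ℤ.* d) + (a ℤ.* d ℤ.+ b ℤ.* c ℤ.+ b ℤ.* d) ω

-- complex conjugation: ω̄ = 1 - ω
conj : ℤω → ℤω
conj (a + b ω) = (a ℤ.+ b) + (ℤ.- b) ω

ωc : ℤω
ωc = (+ 0) + (+ 1) ω

-- γ = e^{2πi/3} = ω² = ω - 1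
γc : ℤω
γc = -[1+ 0 ] + (+ 1) ω

-- relation between an ordered pair (u , v):
--   none : not adjacent, digon : u ∼ v, out : u → v, inn : v → u
data Adj : Set where
  none digon out inn : Adj

rev : Adj → Adj
rev none  = none
rev digon = digon
rev out   = inn
rev inn   = out

record MixedGraph (n : ℕ) : Set where
  field
    rel   : Fin n → Fin n → Adj
    loopless : ∀ u → rel u u ≡ none
    consistent : ∀ u v → rel v u ≡ rev (rel u v)
open MixedGraph public

Adjacent : ∀ {n} → MixedGraph n → Fin n → Fin n → Set
Adjacent D u v = ¬ (rel D u v ≡ none)

Bipartite : ∀ {n} → MixedGraph n → Set
Bipartite {n} D = ∃ λ (c : Fin n → Bool) → ∀ u v → Adjacent D u v → c u ≢ c v

cycPairs : ∀ {n} → List (Fin n) → List (Fin n × Fin n)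
cycPairs [] = []
cycPairs (x ∷ xs) = go (x ∷ xs)
  where
  go : List _ → List _
  go [] = []
  go (a ∷ []) = (a , x) ∷ []
  go (a ∷ b ∷ r) = (a , b) ∷ go (b ∷ r)

IsCycle : ∀ {n} → MixedGraph n → List (Fin n) → Set
IsCycle D vs = Unique vs × 3 ≤ length vs × All (λ p → Adjacent D (Data.Product.proj₁ p) (Data.Product.proj₂ p)) (cycPairs vs)

isDigon : Adj → Bool
isDigon digon = Bool.true
isDigon _     = Bool.false

countDigons : ∀ {n} → MixedGraph n → List (Fin n × Fin n) → ℕ
countDigons D [] = 0
countDigons D ((u , v) ∷ ps) with isDigon (rel D u v)
... | Bool.true  = suc (countDigons D ps)
... | Bool.false = countDigons D ps

digonsOnCycle : ∀ {n} → MixedGraph n → List (Fin n) → ℕ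
digonsOnCycle D vs = countDigons D (cycPairs vs)

entry : ℤω → Adj → ℤω
entry α none  = 0w
entry α digon = 1w
entry α out   = α
entry α inn   = conj α

H : ∀ {n} → ℤω → MixedGraph n → Fin n → Fin n → ℤω
H α D u v = entry α (rel D u v)

-- Polynomials over ℤ[ω] (coefficient lists, lowest degree first)

Poly : Set
Poly = List ℤω

_+P_ : Poly → Poly → Poly
[] +P q = q
(a ∷ p) +P [] = a ∷ p
(a ∷ p) +P (b ∷ q) = (a +w b) ∷ (p +P q)

-P_ : Poly → Poly
-P p = map -w_ p

_*P_ : Poly → Poly → Poly
[] *P q = []
(a ∷ p) *P q = map (a *w_) q +P (0w ∷ (p *P q))

1P XP : Poly
1P = 1w ∷ []
XP = 0w ∷ 1w ∷ []

_≈P_ : Poly → Poly → Set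
[] ≈P q = All (_≡ 0w) q
(a ∷ p) ≈P [] = All (_≡ 0w) (a ∷ p)
(a ∷ p) ≈P (b ∷ q) = (a ≡ b) × (p ≈P q)

sgn : ℕ → Poly → Poly
sgn zero p = p
sgn (suc k) p = -P (sgn k p)

det : ∀ n → (Fin n → Fin n → Poly) → Poly
det zero A = 1P
det (suc n) A =
  foldr _+P_ [] (map (λ j → sgn (Data.Fin.toℕ j)
                    (A zero j *P det n (λ i k → A (suc i) (punchIn j k))))
                  (allFin (suc n)))

charPoly : ∀ {n} → (Fin n → Fin n → ℤω) → Poly
charPoly {n} M = det n (λ i j → diag i j +P (-P (M i j ∷ [])))
  where
  diag : Fin n → Fin n → Poly
  diag i j with i ≟ j
  ... | yes _ = XP
  ... | no _  = []

-- σ_α(D) = σ_β(D): equal spectra (multisets of eigenvalues), i.e.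
-- equal characteristic polynomials
SameSpectrum : ∀ {n} → (Fin n → Fin n → ℤω) → (Fin n → Fin n → ℤω) → Set
SameSpectrum M N = charPoly M ≈P charPoly N

-- Since ω = −γ̄, an arc u → v contributes ω to H^ω(D)ᵤᵥ and −ω to H^γ(D)ᵥᵤ, while a digon
-- contributes 1 to both. So if s : V → {±1} has s(u)s(v) = −1 on arcs and +1 on digons, then
-- H^ω = S (H^γ)ᵀ S for S = diag(s), and xI − H^ω = S (xI − H^γ)ᵀ S has the same determinant
-- as xI − H^γ. Such an s exists: since every cycle has an even number of digons, so does every
-- closed walk, hence the digon parities of the paths in a spanning forest form a potential φ
-- with φ(u) + φ(v) ≡ [uv is a digon] (mod 2), and s = (−1)^(φ + c) for a proper 2-colouring c.

module Submission where

open import Defs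
open import Data.Nat using (ℕ; zero; suc; _<_; s≤s; z≤n)
open import Data.Nat.Base using (parity)
open import Data.Nat.Divisibility using (_∣_; divides)
open import Data.Nat.Induction using (<-wellFounded)
open import Data.Nat.Properties using (<-≤-trans; n<1+n; m<n⇒m<1+n)
open import Data.Fin using (Fin; zero; suc; punchIn; toℕ; _≟_)
open import Data.Bool using (Bool; true; false)
open import Data.Parity.Base as ℙ using (Parity; 0ℙ; 1ℙ)
import Data.Parity.Properties as ℙ
import Data.Integer as ℤ
import Data.Integer.Properties as ℤ
open import Data.Integer.Tactic.RingSolver using (solve-∀)
open import Data.List using (List; []; _∷_; _++_; [_]; length; drop; map; foldr; tabulate; allFin; cartesianProduct)
open import Data.List.Properties using (++-assoc; length-++-≤ʳ)
open import Data.List.Relation.Unary.All using (All; []; _∷_)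
open import Data.List.Relation.Unary.All.Properties using (++⁺; ++⁻; ¬Any⇒All¬)
open import Data.List.Relation.Unary.Any using (here; there)
open import Data.List.Relation.Unary.Unique.Propositional using (Unique; []; _∷_)
open import Data.List.Membership.Propositional using (_∈_)
open import Data.List.Membership.Propositional.Properties using (∈-∃++; ∈-allFin; ∈-cartesianProduct⁺)
import Data.List.Membership.DecPropositional as DecMembership
open import Data.Maybe using (nothing)
open import Data.Product using (Σ-syntax; ∃; _×_; _,_; proj₁; proj₂)
open import Data.Sum using (_⊎_; inj₁; inj₂)
open import Data.Empty using (⊥-elim)
open import Data.Vec.Functional as Vector using (Vector)
open import Function using (_∘_)
open import Level using (Level; 0ℓ)
open import Relation.Binary.PropositionalEquality
  using (_≡_; _≢_; refl; sym; trans; cong; cong₂; subst; subst₂; isEquivalence; module ≡-Reasoning)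
open import Relation.Binary.Bundles using (Setoid)
open import Relation.Binary.Structures using (IsEquivalence)
open import Relation.Binary.Definitions using (DecidableEquality)
import Relation.Binary.Reasoning.Setoid as SetoidReasoning
open import Relation.Nullary using (Dec; yes; no)
open import Relation.Nullary.Decidable using (¬?)
open import Induction.WellFounded using (Acc; acc)
open import Algebra.Bundles using (CommutativeRing; AbelianGroup)
open import Algebra.Structures using (IsCommutativeRing; IsAbelianGroup)
open import Algebra.Definitions {A = ℤω} _≡_
  using (Associative; Commutative; LeftIdentity; LeftInverse; _DistributesOverˡ_)
open import Algebra.Consequences.Propositional using (comm∧idˡ⇒id; comm∧invˡ⇒inv; comm∧distrˡ⇒distrʳ)
import Algebra.Properties.CommutativeSemigroup as CommutativeSemigroupProperties
import Algebra.Properties.Monoid.Sum as MonoidSum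
import Algebra.Properties.Semiring.Sum as SemiringSum
import Algebra.Properties.Ring as RingProperties
open import Algebra.Properties.Group ℙ.+-0-group using (x∙y⁻¹≈ε⇒x≈y)
open import Tactic.RingSolver.Core.AlmostCommutativeRing using (fromCommutativeRing)
import Tactic.RingSolver.NonReflective as RingSolver

private
  variable
    a : Level
    A : Set a

-- The Eisenstein integers

+w-assoc : Associative _+w_
+w-assoc (a + b ω) (c + d ω) (e + f ω) = cong₂ _+_ω (ℤ.+-assoc a c e) (ℤ.+-assoc b d f)

+w-comm : Commutative _+w_
+w-comm (a + b ω) (c + d ω) = cong₂ _+_ω (ℤ.+-comm a c) (ℤ.+-comm b d)

+w-identityˡ : LeftIdentity 0w _+w_
+w-identityˡ (a + b ω) = cong₂ _+_ω (ℤ.+-identityˡ a) (ℤ.+-identityˡ b)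

-w-inverseˡ : LeftInverse 0w -w_ _+w_
-w-inverseˡ (a + b ω) = cong₂ _+_ω (ℤ.+-inverseˡ a) (ℤ.+-inverseˡ b)

*w-comm : Commutative _*w_
*w-comm (a + b ω) (c + d ω) = cong₂ _+_ω (re-eq a b c d) (im-eq a b c d)
  where
  re-eq : ∀ a b c d → a ℤ.* c ℤ.- b ℤ.* d ≡ c ℤ.* a ℤ.- d ℤ.* b
  re-eq = solve-∀
  im-eq : ∀ a b c d → a ℤ.* d ℤ.+ b ℤ.* c ℤ.+ b ℤ.* d ≡ c ℤ.* b ℤ.+ d ℤ.* a ℤ.+ d ℤ.* b
  im-eq = solve-∀

*w-assoc : Associative _*w_
*w-assoc (a + b ω) (c + d ω) (e + f ω) = cong₂ _+_ω (re-eq a b c d e f) (im-eq a b c d e f)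
  where
  re-eq : ∀ a b c d e f →
    (a ℤ.* c ℤ.- b ℤ.* d) ℤ.* e ℤ.- (a ℤ.* d ℤ.+ b ℤ.* c ℤ.+ b ℤ.* d) ℤ.* f
    ≡ a ℤ.* (c ℤ.* e ℤ.- d ℤ.* f) ℤ.- b ℤ.* (c ℤ.* f ℤ.+ d ℤ.* e ℤ.+ d ℤ.* f)
  re-eq = solve-∀
  im-eq : ∀ a b c d e f →
    (a ℤ.* c ℤ.- b ℤ.* d) ℤ.* f ℤ.+ (a ℤ.* d ℤ.+ b ℤ.* c ℤ.+ b ℤ.* d) ℤ.* e
      ℤ.+ (a ℤ.* d ℤ.+ b ℤ.* c ℤ.+ b ℤ.* d) ℤ.* f
    ≡ a ℤ.* (c ℤ.* f ℤ.+ d ℤ.* e ℤ.+ d ℤ.* f) ℤ.+ b ℤ.* (c ℤ.* e ℤ.- d ℤ.* f)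
      ℤ.+ b ℤ.* (c ℤ.* f ℤ.+ d ℤ.* e ℤ.+ d ℤ.* f)
  im-eq = solve-∀

*w-identityˡ : LeftIdentity 1w _*w_
*w-identityˡ (a + b ω) = cong₂ _+_ω (re-eq a b) (im-eq a b)
  where
  re-eq : ∀ a b → ℤ.1ℤ ℤ.* a ℤ.- ℤ.0ℤ ℤ.* b ≡ a
  re-eq = solve-∀
  im-eq : ∀ a b → ℤ.1ℤ ℤ.* b ℤ.+ ℤ.0ℤ ℤ.* a ℤ.+ ℤ.0ℤ ℤ.* b ≡ b
  im-eq = solve-∀

*w-distribˡ : _*w_ DistributesOverˡ _+w_
*w-distribˡ (a + b ω) (c + d ω) (e + f ω) = cong₂ _+_ω (re-eq a b c d e f) (im-eq a b c d e f)
  where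
  re-eq : ∀ a b c d e f →
    a ℤ.* (c ℤ.+ e) ℤ.- b ℤ.* (d ℤ.+ f) ≡ (a ℤ.* c ℤ.- b ℤ.* d) ℤ.+ (a ℤ.* e ℤ.- b ℤ.* f)
  re-eq = solve-∀
  im-eq : ∀ a b c d e f →
    a ℤ.* (d ℤ.+ f) ℤ.+ b ℤ.* (c ℤ.+ e) ℤ.+ b ℤ.* (d ℤ.+ f)
    ≡ (a ℤ.* d ℤ.+ b ℤ.* c ℤ.+ b ℤ.* d) ℤ.+ (a ℤ.* f ℤ.+ b ℤ.* e ℤ.+ b ℤ.* f)
  im-eq = solve-∀

ℤω-isCommutativeRing : IsCommutativeRing _≡_ _+w_ _*w_ -w_ 0w 1w
ℤω-isCommutativeRing = record
  { isRing = record
    { +-isAbelianGroup = record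
      { isGroup = record
        { isMonoid = record
          { isSemigroup = record
            { isMagma = record { isEquivalence = isEquivalence ; ∙-cong = cong₂ _+w_ }
            ; assoc   = +w-assoc
            }
          ; identity = comm∧idˡ⇒id +w-comm +w-identityˡ
          }
        ; inverse = comm∧invˡ⇒inv +w-comm -w-inverseˡ
        ; ⁻¹-cong = cong -w_
        }
      ; comm = +w-comm
      }
    ; *-cong     = cong₂ _*w_
    ; *-assoc    = *w-assoc
    ; *-identity = comm∧idˡ⇒id *w-comm *w-identityˡ
    ; distrib    = *w-distribˡ , comm∧distrˡ⇒distrʳ *w-comm *w-distribˡ
    }
  ; *-comm = *w-comm
  }

ℤω-commutativeRing : CommutativeRing 0ℓ 0ℓ
ℤω-commutativeRing = record { isCommutativeRing = ℤω-isCommutativeRing }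

module Eisenstein = CommutativeRing ℤω-commutativeRing

-- Polynomials over the Eisenstein integers

coeff : Poly → ℕ → ℤω
coeff []      k       = 0w
coeff (a ∷ p) zero    = a
coeff (a ∷ p) (suc k) = coeff p k

infix 4 _≋_

record _≋_ (p q : Poly) : Set where
  constructor coeffwise
  field coeff-≡ : ∀ k → coeff p k ≡ coeff q k
open _≋_

≋-isEquivalence : IsEquivalence _≋_
≋-isEquivalence = record
  { refl  = coeffwise λ _ → refl
  ; sym   = λ p≋q → coeffwise λ k → sym (coeff-≡ p≋q k)
  ; trans = λ p≋q q≋r → coeffwise λ k → trans (coeff-≡ p≋q k) (coeff-≡ q≋r k)
  }

≋-setoid : Setoid 0ℓ 0ℓ
≋-setoid = record { isEquivalence = ≋-isEquivalence }

open Setoid ≋-setoid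
  using () renaming (refl to ≋-refl; reflexive to ≋-reflexive; sym to ≋-sym; trans to ≋-trans)

module ≋-Reasoning = SetoidReasoning ≋-setoid

≋[]⇒All≡0w : ∀ p → p ≋ [] → All (_≡ 0w) p
≋[]⇒All≡0w []      p≋[] = []
≋[]⇒All≡0w (a ∷ p) p≋[] = coeff-≡ p≋[] zero ∷ ≋[]⇒All≡0w p (coeffwise (coeff-≡ p≋[] ∘ suc))

≋⇒≈P : ∀ p q → p ≋ q → p ≈P q
≋⇒≈P []      q       p≋q = ≋[]⇒All≡0w q (≋-sym p≋q)
≋⇒≈P (a ∷ p) []      p≋q = ≋[]⇒All≡0w (a ∷ p) p≋q
≋⇒≈P (a ∷ p) (b ∷ q) p≋q = coeff-≡ p≋q zero , ≋⇒≈P p q (coeffwise (coeff-≡ p≋q ∘ suc))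

∷-cong : ∀ {a b p q} → a ≡ b → p ≋ q → (a ∷ p) ≋ (b ∷ q)
∷-cong a≡b p≋q = coeffwise λ where
  zero    → a≡b
  (suc k) → coeff-≡ p≋q k

scale : ℤω → Poly → Poly
scale a = map (a *w_)

shift : Poly → Poly
shift p = 0w ∷ p

coeff-+P : ∀ p q k → coeff (p +P q) k ≡ coeff p k +w coeff q k
coeff-+P []      q       k       = sym (Eisenstein.+-identityˡ (coeff q k))
coeff-+P (a ∷ p) []      k       = sym (Eisenstein.+-identityʳ (coeff (a ∷ p) k))
coeff-+P (a ∷ p) (b ∷ q) zero    = refl
coeff-+P (a ∷ p) (b ∷ q) (suc k) = coeff-+P p q k

coeff--P : ∀ p k → coeff (-P p) k ≡ -w coeff p k
coeff--P []      k       = refl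
coeff--P (a ∷ p) zero    = refl
coeff--P (a ∷ p) (suc k) = coeff--P p k

coeff-scale : ∀ a q k → coeff (scale a q) k ≡ a *w coeff q k
coeff-scale a []      k       = sym (Eisenstein.zeroʳ a)
coeff-scale a (b ∷ q) zero    = refl
coeff-scale a (b ∷ q) (suc k) = coeff-scale a q k

+P-coeffwise : ∀ p q r s → (∀ k → coeff p k +w coeff q k ≡ coeff r k +w coeff s k) → p +P q ≋ r +P s
+P-coeffwise p q r s eq = coeffwise λ k → trans (coeff-+P p q k) (trans (eq k) (sym (coeff-+P r s k)))

+P-cong : ∀ {p p′ q q′} → p ≋ p′ → q ≋ q′ → p +P q ≋ p′ +P q′
+P-cong {p} {p′} {q} {q′} p≋p′ q≋q′ =
  +P-coeffwise p q p′ q′ (λ k → cong₂ _+w_ (coeff-≡ p≋p′ k) (coeff-≡ q≋q′ k))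

+P-congˡ : ∀ {p q q′} → q ≋ q′ → p +P q ≋ p +P q′
+P-congˡ = +P-cong ≋-refl

+P-congʳ : ∀ {p p′ q} → p ≋ p′ → p +P q ≋ p′ +P q
+P-congʳ p≋p′ = +P-cong p≋p′ ≋-refl

+P-comm : ∀ p q → p +P q ≋ q +P p
+P-comm p q = +P-coeffwise p q q p (λ k → Eisenstein.+-comm (coeff p k) (coeff q k))

+P-assoc : ∀ p q r → (p +P q) +P r ≋ p +P (q +P r)
+P-assoc p q r = +P-coeffwise (p +P q) r p (q +P r) λ k → begin
  coeff (p +P q) k +w coeff r k          ≡⟨ cong (_+w coeff r k) (coeff-+P p q k) ⟩
  (coeff p k +w coeff q k) +w coeff r k  ≡⟨ Eisenstein.+-assoc (coeff p k) (coeff q k) (coeff r k) ⟩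
  coeff p k +w (coeff q k +w coeff r k)  ≡⟨ cong (coeff p k +w_) (coeff-+P q r k) ⟨
  coeff p k +w coeff (q +P r) k          ∎
  where open ≡-Reasoning

+P-identityʳ : ∀ p → p +P [] ≋ p
+P-identityʳ p = coeffwise λ k → trans (coeff-+P p [] k) (Eisenstein.+-identityʳ (coeff p k))

-P-inverseˡ : ∀ p → (-P p) +P p ≋ []
-P-inverseˡ p = coeffwise λ k →
  trans (coeff-+P (-P p) p k) (trans (cong (_+w coeff p k) (coeff--P p k)) (Eisenstein.-‿inverseˡ (coeff p k)))

-P-cong : ∀ {p q} → p ≋ q → -P p ≋ -P q
-P-cong {p} {q} p≋q = coeffwise λ k →
  trans (coeff--P p k) (trans (cong -w_ (coeff-≡ p≋q k)) (sym (coeff--P q k)))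

+P-isAbelianGroup : IsAbelianGroup _≋_ _+P_ [] -P_
+P-isAbelianGroup = record
  { isGroup = record
    { isMonoid = record
      { isSemigroup = record
        { isMagma = record { isEquivalence = ≋-isEquivalence ; ∙-cong = +P-cong }
        ; assoc   = +P-assoc
        }
      ; identity = (λ _ → ≋-refl) , +P-identityʳ
      }
    ; inverse = -P-inverseˡ , λ p → ≋-trans (+P-comm p (-P p)) (-P-inverseˡ p)
    ; ⁻¹-cong = -P-cong
    }
  ; comm = +P-comm
  }

+P-abelianGroup : AbelianGroup 0ℓ 0ℓ
+P-abelianGroup = record { isAbelianGroup = +P-isAbelianGroup }

private
  module +P = CommutativeSemigroupProperties (AbelianGroup.commutativeSemigroup +P-abelianGroup)

scale-cong : ∀ a {q q′} → q ≋ q′ → scale a q ≋ scale a q′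
scale-cong a {q} {q′} q≋q′ = coeffwise λ k →
  trans (coeff-scale a q k) (trans (cong (a *w_) (coeff-≡ q≋q′ k)) (sym (coeff-scale a q′ k)))

scale-zero : ∀ q → scale 0w q ≋ []
scale-zero q = coeffwise λ k → trans (coeff-scale 0w q k) (Eisenstein.zeroˡ (coeff q k))

scale-identity : ∀ q → scale 1w q ≋ q
scale-identity q = coeffwise λ k → trans (coeff-scale 1w q k) (Eisenstein.*-identityˡ (coeff q k))

scale-distrib : ∀ a q r → scale a (q +P r) ≋ scale a q +P scale a r
scale-distrib a q r = coeffwise λ k → begin
  coeff (scale a (q +P r)) k                  ≡⟨ coeff-scale a (q +P r) k ⟩
  a *w coeff (q +P r) k                       ≡⟨ cong (a *w_) (coeff-+P q r k) ⟩
  a *w (coeff q k +w coeff r k)               ≡⟨ Eisenstein.distribˡ a (coeff q k) (coeff r k) ⟩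
  (a *w coeff q k) +w (a *w coeff r k)        ≡⟨ cong₂ _+w_ (coeff-scale a q k) (coeff-scale a r k) ⟨
  coeff (scale a q) k +w coeff (scale a r) k  ≡⟨ coeff-+P (scale a q) (scale a r) k ⟨
  coeff (scale a q +P scale a r) k            ∎
  where open ≡-Reasoning

scale-*w : ∀ a b q → scale (a *w b) q ≋ scale a (scale b q)
scale-*w a b q = coeffwise λ k → begin
  coeff (scale (a *w b) q) k     ≡⟨ coeff-scale (a *w b) q k ⟩
  (a *w b) *w coeff q k          ≡⟨ Eisenstein.*-assoc a b (coeff q k) ⟩
  a *w (b *w coeff q k)          ≡⟨ cong (a *w_) (coeff-scale b q k) ⟨
  a *w coeff (scale b q) k       ≡⟨ coeff-scale a (scale b q) k ⟨
  coeff (scale a (scale b q)) k  ∎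
  where open ≡-Reasoning

shift-cong : ∀ {p q} → p ≋ q → shift p ≋ shift q
shift-cong = ∷-cong refl

shift-[] : shift [] ≋ []
shift-[] = coeffwise λ where
  zero    → refl
  (suc k) → refl

shift-+P : ∀ p q → shift (p +P q) ≋ shift p +P shift q
shift-+P p q = coeffwise λ where
  zero    → refl
  (suc k) → refl

shift-scale : ∀ a q → shift (scale a q) ≋ scale a (shift q)
shift-scale a q = ∷-cong (sym (Eisenstein.zeroʳ a)) ≋-refl

*P-zeroʳ : ∀ p → p *P [] ≋ []
*P-zeroʳ []      = ≋-refl
*P-zeroʳ (a ∷ p) = ≋-trans (shift-cong (*P-zeroʳ p)) shift-[]

*P-congˡ : ∀ p {q q′} → q ≋ q′ → p *P q ≋ p *P q′
*P-congˡ []      q≋q′ = ≋-refl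
*P-congˡ (a ∷ p) q≋q′ = +P-cong (scale-cong a q≋q′) (shift-cong (*P-congˡ p q≋q′))

*P-consʳ : ∀ q a p → q *P (a ∷ p) ≋ scale a q +P shift (q *P p)
*P-consʳ []      a p = ≋-sym shift-[]
*P-consʳ (b ∷ q) a p = ∷-cong (cong (_+w 0w) (Eisenstein.*-comm b a)) (begin
  scale b p +P (q *P (a ∷ p))               ≈⟨ +P-congˡ (*P-consʳ q a p) ⟩
  scale b p +P (scale a q +P shift (q *P p))  ≈⟨ +P.x∙yz≈y∙xz (scale b p) (scale a q) (shift (q *P p)) ⟩
  scale a q +P (scale b p +P shift (q *P p))  ∎)
  where open ≋-Reasoning

*P-comm : ∀ p q → p *P q ≋ q *P p
*P-comm []      q = ≋-sym (*P-zeroʳ q)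
*P-comm (a ∷ p) q = begin
  scale a q +P shift (p *P q)  ≈⟨ +P-congˡ (shift-cong (*P-comm p q)) ⟩
  scale a q +P shift (q *P p)  ≈⟨ *P-consʳ q a p ⟨
  q *P (a ∷ p)                 ∎
  where open ≋-Reasoning

*P-congʳ : ∀ {p p′} q → p ≋ p′ → p *P q ≋ p′ *P q
*P-congʳ {p} {p′} q p≋p′ = ≋-trans (*P-comm p q) (≋-trans (*P-congˡ q p≋p′) (*P-comm q p′))

*P-cong : ∀ {p p′ q q′} → p ≋ p′ → q ≋ q′ → p *P q ≋ p′ *P q′
*P-cong {p′ = p′} {q = q} p≋p′ q≋q′ = ≋-trans (*P-congʳ q p≋p′) (*P-congˡ p′ q≋q′)

*P-distribˡ : ∀ p q r → p *P (q +P r) ≋ (p *P q) +P (p *P r)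
*P-distribˡ []      q r = ≋-refl
*P-distribˡ (a ∷ p) q r = begin
  scale a (q +P r) +P shift (p *P (q +P r))
    ≈⟨ +P-cong (scale-distrib a q r) (shift-cong (*P-distribˡ p q r)) ⟩
  (scale a q +P scale a r) +P shift ((p *P q) +P (p *P r))
    ≈⟨ +P-congˡ (shift-+P (p *P q) (p *P r)) ⟩
  (scale a q +P scale a r) +P (shift (p *P q) +P shift (p *P r))
    ≈⟨ +P.interchange (scale a q) (scale a r) (shift (p *P q)) (shift (p *P r)) ⟩
  (scale a q +P shift (p *P q)) +P (scale a r +P shift (p *P r))
    ∎
  where open ≋-Reasoning

*P-distribʳ : ∀ r p q → (p +P q) *P r ≋ (p *P r) +P (q *P r)
*P-distribʳ r p q = begin
  (p +P q) *P r         ≈⟨ *P-comm (p +P q) r ⟩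
  r *P (p +P q)         ≈⟨ *P-distribˡ r p q ⟩
  (r *P p) +P (r *P q)  ≈⟨ +P-cong (*P-comm r p) (*P-comm r q) ⟩
  (p *P r) +P (q *P r)  ∎
  where open ≋-Reasoning

scale-*P : ∀ a q r → scale a q *P r ≋ scale a (q *P r)
scale-*P a []      r = ≋-refl
scale-*P a (b ∷ q) r = begin
  scale (a *w b) r +P shift (scale a q *P r)
    ≈⟨ +P-cong (scale-*w a b r) (shift-cong (scale-*P a q r)) ⟩
  scale a (scale b r) +P shift (scale a (q *P r))
    ≈⟨ +P-congˡ (shift-scale a (q *P r)) ⟩
  scale a (scale b r) +P scale a (shift (q *P r))
    ≈⟨ scale-distrib a (scale b r) (shift (q *P r)) ⟨
  scale a (scale b r +P shift (q *P r))
    ∎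
  where open ≋-Reasoning

shift-*P : ∀ p r → shift p *P r ≋ shift (p *P r)
shift-*P p r = +P-congʳ (scale-zero r)

*P-assoc : ∀ p q r → (p *P q) *P r ≋ p *P (q *P r)
*P-assoc []      q r = ≋-refl
*P-assoc (a ∷ p) q r = begin
  (scale a q +P shift (p *P q)) *P r
    ≈⟨ *P-distribʳ r (scale a q) (shift (p *P q)) ⟩
  (scale a q *P r) +P (shift (p *P q) *P r)
    ≈⟨ +P-cong (scale-*P a q r) (shift-*P (p *P q) r) ⟩
  scale a (q *P r) +P shift ((p *P q) *P r)
    ≈⟨ +P-congˡ (shift-cong (*P-assoc p q r)) ⟩
  scale a (q *P r) +P shift (p *P (q *P r))
    ∎
  where open ≋-Reasoning

*P-identityˡ : ∀ p → 1P *P p ≋ p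
*P-identityˡ p = ≋-trans (+P-cong (scale-identity p) shift-[]) (+P-identityʳ p)

Poly-isCommutativeRing : IsCommutativeRing _≋_ _+P_ _*P_ -P_ [] 1P
Poly-isCommutativeRing = record
  { isRing = record
    { +-isAbelianGroup = +P-isAbelianGroup
    ; *-cong           = *P-cong
    ; *-assoc          = *P-assoc
    ; *-identity       = *P-identityˡ , λ p → ≋-trans (*P-comm p 1P) (*P-identityˡ p)
    ; distrib          = *P-distribˡ , *P-distribʳ
    }
  ; *-comm = *P-comm
  }

Poly-commutativeRing : CommutativeRing 0ℓ 0ℓ
Poly-commutativeRing = record { isCommutativeRing = Poly-isCommutativeRing }

*P-involution : ∀ t p → t *P t ≋ 1P → t *P (t *P p) ≋ p
*P-involution t p t²≋1 = ≋-trans (≋-sym (*P-assoc t t p)) (≋-trans (*P-congʳ p t²≋1) (*P-identityˡ p))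

constant : ℤω → Poly
constant a = a ∷ []

constant-*P : ∀ a b → constant a *P constant b ≋ constant (a *w b)
constant-*P a b = ∷-cong (Eisenstein.+-identityʳ (a *w b)) ≋-refl

-- Determinants over a commutative ring

module Determinant {c ℓ} (R : CommutativeRing c ℓ) where

  open CommutativeRing R hiding (zero) renaming (refl to ≈-refl; sym to ≈-sym; trans to ≈-trans)
  open RingProperties ring using (-‿distribʳ-*; -‿distribˡ-*)
  open CommutativeSemigroupProperties *-commutativeSemigroup using (interchange)
  open SemiringSum semiring using (sum; sum-syntax; ∑-comm; sum-cong-≋; *-distribˡ-sum)
  open SetoidReasoning setoid
  open RingSolver (fromCommutativeRing R (λ _ → nothing)) using (solve; _⊜_; _⊗_; ⊝_)

  Matrix : ℕ → Set c
  Matrix n = Fin n → Fin n → Carrier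

  _ᵀ : ∀ {n} → Matrix n → Matrix n
  (A ᵀ) i j = A j i

  minor : ∀ {n} → Matrix (suc n) → Fin (suc n) → Fin (suc n) → Matrix n
  minor A i j r k = A (punchIn i r) (punchIn j k)

  signed : ℕ → Carrier → Carrier
  signed zero    x = x
  signed (suc k) x = - signed k x

  determinant : ∀ n → Matrix n → Carrier
  determinant zero    A = 1#
  determinant (suc n) A = ∑[ j < suc n ] signed (toℕ j) (A zero j * determinant n (minor A zero j))

  product : ∀ {n} → Vector Carrier n → Carrier
  product = Vector.foldr _*_ 1#

  signed-cong : ∀ k {x y} → x ≈ y → signed k x ≈ signed k y
  signed-cong zero    x≈y = x≈y
  signed-cong (suc k) x≈y = -‿cong (signed-cong k x≈y)

  signed≈* : ∀ k x → signed k x ≈ signed k 1# * x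
  signed≈* zero    x = ≈-sym (*-identityˡ x)
  signed≈* (suc k) x = ≈-trans (-‿cong (signed≈* k x)) (-‿distribˡ-* (signed k 1#) x)

  signed-*ˡ : ∀ k a x → signed k (a * x) ≈ a * signed k x
  signed-*ˡ zero    a x = ≈-refl
  signed-*ˡ (suc k) a x = ≈-trans (-‿cong (signed-*ˡ k a x)) (-‿distribʳ-* a (signed k x))

  signed-*-sum : ∀ k a {m} (f : Vector Carrier m) → signed k (a * sum f) ≈ ∑[ i < m ] signed k (a * f i)
  signed-*-sum k a {m} f = begin
    signed k (a * sum f)                  ≈⟨ signed≈* k (a * sum f) ⟩
    signed k 1# * (a * sum f)             ≈⟨ *-congˡ (*-distribˡ-sum a f) ⟩
    signed k 1# * ∑[ i < m ] (a * f i)    ≈⟨ *-distribˡ-sum (signed k 1#) (λ i → a * f i) ⟩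
    ∑[ i < m ] (signed k 1# * (a * f i))  ≈⟨ sum-cong-≋ (λ i → signed≈* k (a * f i)) ⟨
    ∑[ i < m ] signed k (a * f i)         ∎

  signed-exchange : ∀ j r a b x → signed (suc j) (a * signed r (b * x)) ≈ signed (suc r) (b * signed j (a * x))
  signed-exchange j r a b x = begin
    signed (suc j) (a * signed r (b * x))  ≈⟨ signed≈* (suc j) (a * signed r (b * x)) ⟩
    - εj * (a * signed r (b * x))          ≈⟨ *-congˡ (*-congˡ (signed≈* r (b * x))) ⟩
    - εj * (a * (εr * (b * x)))            ≈⟨ exchange εj εr a b x ⟩
    - εr * (b * (εj * (a * x)))            ≈⟨ *-congˡ (*-congˡ (signed≈* j (a * x))) ⟨
    - εr * (b * signed j (a * x))          ≈⟨ signed≈* (suc r) (b * signed j (a * x)) ⟨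
    signed (suc r) (b * signed j (a * x))  ∎
    where
    εj εr : Carrier
    εj = signed j 1#
    εr = signed r 1#
    exchange : ∀ e f a b x → - e * (a * (f * (b * x))) ≈ - f * (b * (e * (a * x)))
    exchange = solve 5 (λ e f a b x → (⊝ e) ⊗ (a ⊗ (f ⊗ (b ⊗ x))) ⊜ (⊝ f) ⊗ (b ⊗ (e ⊗ (a ⊗ x)))) ≈-refl

  determinant-cong : ∀ n {A B : Matrix n} → (∀ i j → A i j ≈ B i j) → determinant n A ≈ determinant n B
  determinant-cong zero    A≈B = ≈-refl
  determinant-cong (suc n) A≈B = sum-cong-≋ λ j →
    signed-cong (toℕ j) (*-cong (A≈B zero j) (determinant-cong n (λ r k → A≈B (suc r) (punchIn j k))))

  -- Expanding one level further, both sides become the same double sum over the minors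
  -- F j r that omit rows 0, 1 + r and columns 0, 1 + j.
  determinant-expandColumn : ∀ n (A : Matrix (suc n)) →
    determinant (suc n) A ≈ ∑[ i < suc n ] signed (toℕ i) (A i zero * determinant n (minor A i zero))
  determinant-expandColumn zero    A = ≈-refl
  determinant-expandColumn (suc m) A = +-congˡ (begin
    ∑[ j < suc m ] signed (suc (toℕ j)) (A zero (suc j) * determinant (suc m) (minor A zero (suc j)))
      ≈⟨ sum-cong-≋ (λ j → signed-cong (suc (toℕ j))
           (*-congˡ {A zero (suc j)} (determinant-expandColumn m (minor A zero (suc j))))) ⟩
    ∑[ j < suc m ] signed (suc (toℕ j)) (A zero (suc j) * ∑[ r < suc m ] signed (toℕ r) (A (suc r) zero * F j r))
      ≈⟨ sum-cong-≋ (λ j → signed-*-sum (suc (toℕ j)) (A zero (suc j)) (λ r → signed (toℕ r) (A (suc r) zero * F j r))) ⟩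
    ∑[ j < suc m ] ∑[ r < suc m ] signed (suc (toℕ j)) (A zero (suc j) * signed (toℕ r) (A (suc r) zero * F j r))
      ≈⟨ ∑-comm (λ j r → signed (suc (toℕ j)) (A zero (suc j) * signed (toℕ r) (A (suc r) zero * F j r))) ⟩
    ∑[ r < suc m ] ∑[ j < suc m ] signed (suc (toℕ j)) (A zero (suc j) * signed (toℕ r) (A (suc r) zero * F j r))
      ≈⟨ sum-cong-≋ (λ r → sum-cong-≋ (λ j → signed-exchange (toℕ j) (toℕ r) (A zero (suc j)) (A (suc r) zero) (F j r))) ⟩
    ∑[ r < suc m ] ∑[ j < suc m ] signed (suc (toℕ r)) (A (suc r) zero * signed (toℕ j) (A zero (suc j) * F j r))
      ≈⟨ sum-cong-≋ (λ r → signed-*-sum (suc (toℕ r)) (A (suc r) zero) (λ j → signed (toℕ j) (A zero (suc j) * F j r))) ⟨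
    ∑[ r < suc m ] signed (suc (toℕ r)) (A (suc r) zero * determinant (suc m) (minor A (suc r) zero))
      ∎)
    where
    F : Fin (suc m) → Fin (suc m) → Carrier
    F j r = determinant m (λ r′ k → A (suc (punchIn r r′)) (suc (punchIn j k)))

  determinant-transpose : ∀ n (A : Matrix n) → determinant n (A ᵀ) ≈ determinant n A
  determinant-transpose zero    A = ≈-refl
  determinant-transpose (suc n) A = ≈-trans
    (sum-cong-≋ λ j → signed-cong (toℕ j) (*-congˡ {A j zero} (determinant-transpose n (minor A j zero))))
    (≈-sym (determinant-expandColumn n A))

  determinant-scaleRows : ∀ n (s : Vector Carrier n) (A : Matrix n) →
                          determinant n (λ i j → s i * A i j) ≈ product s * determinant n A
  determinant-scaleRows zero    s A = ≈-sym (*-identityˡ 1#)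
  determinant-scaleRows (suc n) s A = begin
    ∑[ j < suc n ] signed (toℕ j) ((s zero * A zero j) * determinant n (λ r k → s (suc r) * minor A zero j r k))
      ≈⟨ sum-cong-≋ (λ j → signed-cong (toℕ j)
           (*-congˡ {s zero * A zero j} (determinant-scaleRows n (s ∘ suc) (minor A zero j)))) ⟩
    ∑[ j < suc n ] signed (toℕ j) ((s zero * A zero j) * (product (s ∘ suc) * D j))
      ≈⟨ sum-cong-≋ (λ j → signed-cong (toℕ j) (interchange (s zero) (A zero j) (product (s ∘ suc)) (D j))) ⟩
    ∑[ j < suc n ] signed (toℕ j) (product s * (A zero j * D j))
      ≈⟨ sum-cong-≋ (λ j → signed-*ˡ (toℕ j) (product s) (A zero j * D j)) ⟩
    ∑[ j < suc n ] (product s * signed (toℕ j) (A zero j * D j))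
      ≈⟨ *-distribˡ-sum (product s) (λ j → signed (toℕ j) (A zero j * D j)) ⟨
    product s * determinant (suc n) A
      ∎
    where
    D : Fin (suc n) → Carrier
    D j = determinant n (minor A zero j)

  product-square : ∀ n (t : Vector Carrier n) → (∀ i → t i * t i ≈ 1#) → product t * product t ≈ 1#
  product-square zero    t t²≈1 = *-identityˡ 1#
  product-square (suc n) t t²≈1 = begin
    (t zero * T′) * (t zero * T′)  ≈⟨ interchange (t zero) T′ (t zero) T′ ⟩
    (t zero * t zero) * (T′ * T′)  ≈⟨ *-cong (t²≈1 zero) (product-square n (t ∘ suc) (t²≈1 ∘ suc)) ⟩
    1# * 1#                        ≈⟨ *-identityˡ 1# ⟩
    1#                             ∎
    where
    T′ : Carrier
    T′ = product (t ∘ suc)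

  determinant-signedTranspose : ∀ n (t : Vector Carrier n) (A : Matrix n) → (∀ i → t i * t i ≈ 1#) →
                                determinant n (λ i j → t i * (t j * A j i)) ≈ determinant n A
  determinant-signedTranspose n t A t²≈1 = begin
    determinant n (λ i j → t i * (t j * A j i))  ≈⟨ determinant-scaleRows n t (λ i j → t j * A j i) ⟩
    T * determinant n (λ i j → t j * A j i)      ≈⟨ *-congˡ (determinant-transpose n (λ i j → t i * A i j)) ⟩
    T * determinant n (λ i j → t i * A i j)      ≈⟨ *-congˡ (determinant-scaleRows n t A) ⟩
    T * (T * determinant n A)                    ≈⟨ *-assoc T T (determinant n A) ⟨
    (T * T) * determinant n A                    ≈⟨ *-congʳ (product-square n t t²≈1) ⟩
    1# * determinant n A                         ≈⟨ *-identityˡ (determinant n A) ⟩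
    determinant n A                              ∎
    where
    T : Carrier
    T = product t

-- Characteristic polynomials and signed transposition

module PolyDet = Determinant Poly-commutativeRing

private
  module PolySum = MonoidSum (CommutativeRing.+-monoid Poly-commutativeRing)

sgn≡signed : ∀ k p → sgn k p ≡ PolyDet.signed k p
sgn≡signed zero    p = refl
sgn≡signed (suc k) p = cong -P_ (sgn≡signed k p)

foldr-map-tabulate : ∀ {b c} {B : Set b} {C : Set c} m (f : B → C → C) e (g : A → B) (h : Fin m → A) →
                     foldr f e (map g (tabulate h)) ≡ Vector.foldr f e (g ∘ h)
foldr-map-tabulate zero    f e g h = refl
foldr-map-tabulate (suc m) f e g h = cong (f (g (h zero))) (foldr-map-tabulate m f e g (h ∘ suc))

det≡determinant : ∀ n A → det n A ≡ PolyDet.determinant n A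
det≡determinant zero    A = refl
det≡determinant (suc n) A = trans (foldr-map-tabulate (suc n) _+P_ [] _ (λ j → j)) (PolySum.sum-cong-≗ λ j →
  trans (sgn≡signed (toℕ j) _)
        (cong (λ d → PolyDet.signed (toℕ j) (A zero j *P d)) (det≡determinant n (PolyDet.minor A zero j))))

-- Defs.charPoly builds xI − M from a where-bound matrix x·I; unification recovers that matrix
-- here, so that charMatrix can refer to it.
charPoly-unfold : ∀ {n} (M : Fin n → Fin n → ℤω) →
                  Σ[ X ∈ (Fin n → Fin n → Poly) ] charPoly M ≡ det n (λ i j → X i j +P (-P (M i j ∷ [])))
charPoly-unfold M = _ , refl

charMatrix : ∀ {n} → (Fin n → Fin n → ℤω) → Fin n → Fin n → Poly
charMatrix M i j = proj₁ (charPoly-unfold M) i j +P (-P (M i j ∷ []))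

sign : Parity → ℤω
sign 0ℙ = 1w
sign 1ℙ = -w 1w

sign-+ : ∀ p q → sign p *w sign q ≡ sign (p ℙ.+ q)
sign-+ 0ℙ 0ℙ = refl
sign-+ 0ℙ 1ℙ = refl
sign-+ 1ℙ 0ℙ = refl
sign-+ 1ℙ 1ℙ = refl

-w-sign-+ : ∀ p q x → -w (sign (p ℙ.+ q) *w x) ≡ sign p *w (sign q *w (-w x))
-w-sign-+ p q x = begin
  -w (sign (p ℙ.+ q) *w x)      ≡⟨ cong (λ y → -w (y *w x)) (sign-+ p q) ⟨
  -w ((sign p *w sign q) *w x)  ≡⟨ RingProperties.-‿distribʳ-* Eisenstein.ring (sign p *w sign q) x ⟩
  (sign p *w sign q) *w (-w x)  ≡⟨ Eisenstein.*-assoc (sign p) (sign q) (-w x) ⟩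
  sign p *w (sign q *w (-w x))  ∎
  where open ≡-Reasoning

module _ {n : ℕ} (s : Fin n → Parity) (M N : Fin n → Fin n → ℤω)
         (N≡±Mᵀ : ∀ i j → N i j ≡ sign (s i ℙ.+ s j) *w M j i) where

  private
    σ : Fin n → ℤω
    σ = sign ∘ s

    t : Fin n → Poly
    t = constant ∘ σ

    t²≋1 : ∀ i → t i *P t i ≋ 1P
    t²≋1 i = ≋-trans (constant-*P (σ i) (σ i))
                     (∷-cong (trans (sign-+ (s i) (s i)) (cong sign (ℙ.p+p≡0ℙ (s i)))) ≋-refl)

  charMatrix-signedTranspose : ∀ i j → charMatrix N i j ≋ t i *P (t j *P charMatrix M j i)
  charMatrix-signedTranspose i j with i ≟ j | j ≟ i
  ... | yes refl | no i≢i   = ⊥-elim (i≢i refl)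
  ... | no i≢j   | yes refl = ⊥-elim (i≢j refl)
  ... | yes refl | yes _    = begin
    XP +P (-P (N i i ∷ []))                    ≈⟨ ≋-reflexive (cong (λ x → XP +P (-P (x ∷ []))) Nᵢᵢ≡Mᵢᵢ) ⟩
    XP +P (-P (M i i ∷ []))                    ≈⟨ *P-involution (t i) (XP +P (-P (M i i ∷ []))) (t²≋1 i) ⟨
    t i *P (t i *P (XP +P (-P (M i i ∷ []))))  ∎
    where
    open ≋-Reasoning
    Nᵢᵢ≡Mᵢᵢ : N i i ≡ M i i
    Nᵢᵢ≡Mᵢᵢ = trans (N≡±Mᵀ i i) (trans (cong (λ p → sign p *w M i i) (ℙ.p+p≡0ℙ (s i))) (Eisenstein.*-identityˡ (M i i)))
  ... | no _     | no _     = begin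
    constant (-w N i j)                    ≈⟨ ≋-reflexive (cong constant -Nᵢⱼ≡) ⟩
    constant (σ i *w (σ j *w (-w M j i)))  ≈⟨ constant-*P (σ i) (σ j *w (-w M j i)) ⟨
    t i *P constant (σ j *w (-w M j i))    ≈⟨ *P-congˡ (t i) (constant-*P (σ j) (-w M j i)) ⟨
    t i *P (t j *P constant (-w M j i))    ∎
    where
    open ≋-Reasoning
    -Nᵢⱼ≡ : -w N i j ≡ σ i *w (σ j *w (-w M j i))
    -Nᵢⱼ≡ = trans (cong -w_ (N≡±Mᵀ i j)) (-w-sign-+ (s i) (s j) (M j i))

  charPoly-signedTranspose : charPoly M ≋ charPoly N
  charPoly-signedTranspose = begin
    charPoly M                                                        ≡⟨ det≡determinant n (charMatrix M) ⟩
    PolyDet.determinant n (charMatrix M)                              ≈⟨ PolyDet.determinant-signedTranspose n t (charMatrix M) t²≋1 ⟨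
    PolyDet.determinant n (λ i j → t i *P (t j *P charMatrix M j i))  ≈⟨ PolyDet.determinant-cong n charMatrix-signedTranspose ⟨
    PolyDet.determinant n (charMatrix N)                              ≡⟨ det≡determinant n (charMatrix N) ⟨
    charPoly N                                                        ∎
    where open ≋-Reasoning

-- Closed walks as vertex lists

steps : List A → List (A × A)
steps []           = []
steps (x ∷ [])     = []
steps (x ∷ y ∷ xs) = (x , y) ∷ steps (y ∷ xs)

steps-++ : ∀ (xs : List A) y ys → steps (xs ++ y ∷ ys) ≡ steps (xs ++ [ y ]) ++ steps (y ∷ ys)
steps-++ []            y ys = refl
steps-++ (x ∷ [])      y ys = refl
steps-++ (x ∷ x′ ∷ xs) y ys = cong ((x , x′) ∷_) (steps-++ (x′ ∷ xs) y ys)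

closedSteps : A → List A → List (A × A)
closedSteps x l = steps (x ∷ l ++ [ x ])

closedSteps-split : ∀ {x : A} {l} b y z → x ∷ l ≡ b ++ y ∷ z →
                    closedSteps x l ≡ steps (b ++ [ y ]) ++ steps (y ∷ z ++ [ x ])
closedSteps-split {x = x} {l} b y z x∷l≡ = begin
  steps ((x ∷ l) ++ [ x ])       ≡⟨ cong (λ xs → steps (xs ++ [ x ])) x∷l≡ ⟩
  steps ((b ++ y ∷ z) ++ [ x ])  ≡⟨ cong steps (++-assoc b (y ∷ z) [ x ]) ⟩
  steps (b ++ y ∷ z ++ [ x ])    ≡⟨ steps-++ b y (z ++ [ x ]) ⟩
  steps (b ++ [ y ]) ++ steps (y ∷ z ++ [ x ]) ∎
  where open ≡-Reasoning

-- Defs.cycPairs recurses through a where-bound helper; dropping the first pair exposes it.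
cycPairs-tail : ∀ {n} (x y : Fin n) l → drop 1 (cycPairs (x ∷ y ∷ l)) ≡ steps (y ∷ l ++ [ x ])
cycPairs-tail x y []      = refl
cycPairs-tail x y (z ∷ l) = cong ((y , z) ∷_) (cycPairs-tail x z l)

cycPairs≡closedSteps : ∀ {n} (x : Fin n) l → cycPairs (x ∷ l) ≡ closedSteps x l
cycPairs≡closedSteps x []      = refl
cycPairs≡closedSteps x (y ∷ l) = cong ((x , y) ∷_) (cycPairs-tail x y l)

Repetition : ∀ {ℓ} {A : Set ℓ} → List A → Set ℓ
Repetition {A = A} xs = Σ[ a ∈ List A ] Σ[ y ∈ A ] Σ[ b ∈ List A ] Σ[ c ∈ List A ] xs ≡ a ++ y ∷ b ++ y ∷ c

unique⊎repetition : DecidableEquality A → (xs : List A) → Unique xs ⊎ Repetition xs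
unique⊎repetition _≟ᴬ_ []       = inj₁ []
unique⊎repetition _≟ᴬ_ (x ∷ xs) with DecMembership._∈?_ _≟ᴬ_ x xs | unique⊎repetition _≟ᴬ_ xs
... | yes x∈xs | _ = let b , c , xs≡ = ∈-∃++ x∈xs in inj₂ ([] , x , b , c , cong (x ∷_) xs≡)
... | no x∉xs  | inj₁ unique = inj₁ (¬Any⇒All¬ xs x∉xs ∷ unique)
... | no _     | inj₂ (a , y , b , c , xs≡) = inj₂ (x ∷ a , y , b , c , cong (x ∷_) xs≡)

shortcut : ∀ {x : A} {l} a y b c → x ∷ l ≡ a ++ y ∷ b ++ y ∷ c → ∃ λ l′ → x ∷ l′ ≡ a ++ y ∷ c
shortcut []      y b c refl = c , refl
shortcut (x ∷ a) y b c refl = a ++ y ∷ c , refl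

length-++-∷-<ˡ : ∀ (b : List A) y c → length b < length (b ++ y ∷ c)
length-++-∷-<ˡ []      y c = s≤s z≤n
length-++-∷-<ˡ (x ∷ b) y c = s≤s (length-++-∷-<ˡ b y c)

length-++-∷-<ʳ : ∀ (b : List A) y c → length c < length (b ++ y ∷ c)
length-++-∷-<ʳ []      y c = n<1+n (length c)
length-++-∷-<ʳ (x ∷ b) y c = m<n⇒m<1+n (length-++-∷-<ʳ b y c)

loop-shorter : ∀ (a : List A) y b c → length (y ∷ b) < length (a ++ y ∷ b ++ y ∷ c)
loop-shorter a y b c = <-≤-trans (s≤s (length-++-∷-<ˡ b y c)) (length-++-≤ʳ (y ∷ b ++ y ∷ c) {a})

shortcut-shorter : ∀ (a : List A) y b c → length (a ++ y ∷ c) < length (a ++ y ∷ b ++ y ∷ c)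
shortcut-shorter []      y b c = s≤s (length-++-∷-<ʳ b y c)
shortcut-shorter (x ∷ a) y b c = s≤s (shortcut-shorter a y b c)

-- Digon parities and switching

bit : Bool → Parity
bit false = 0ℙ
bit true  = 1ℙ

bit-≢ : ∀ {b c} → b ≢ c → bit b ℙ.+ bit c ≡ 1ℙ
bit-≢ {false} {false} b≢c = ⊥-elim (b≢c refl)
bit-≢ {false} {true}  b≢c = refl
bit-≢ {true}  {false} b≢c = refl
bit-≢ {true}  {true}  b≢c = ⊥-elim (b≢c refl)

parity-even : ∀ {m} → 2 ∣ m → parity m ≡ 0ℙ
parity-even (divides q refl) = trans (ℙ.*-homo-* q 2) (ℙ.*-zeroʳ (parity q))

isDigon-rev : ∀ r → isDigon (rev r) ≡ isDigon r
isDigon-rev none  = refl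
isDigon-rev digon = refl
isDigon-rev out   = refl
isDigon-rev inn   = refl

private
  module Parity+ = CommutativeSemigroupProperties ℙ.+-commutativeSemigroup

module SignedGraph {n : ℕ} (D : MixedGraph n) where

  Edge : Fin n × Fin n → Set
  Edge e = Adjacent D (proj₁ e) (proj₂ e)

  adjacent? : ∀ u v → Dec (Adjacent D u v)
  adjacent? u v = ¬? (none? (rel D u v))
    where
    none? : ∀ r → Dec (r ≡ none)
    none? none  = yes refl
    none? digon = no λ ()
    none? out   = no λ ()
    none? inn   = no λ ()

  adjacent-sym : ∀ {u v} → Adjacent D u v → Adjacent D v u
  adjacent-sym {u} {v} uv vu≡none = uv (trans (consistent D v u) (cong rev vu≡none))

  δ : Fin n → Fin n → Parity
  δ u v = bit (isDigon (rel D u v))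

  δ-sym : ∀ u v → δ v u ≡ δ u v
  δ-sym u v = cong bit (trans (cong isDigon (consistent D u v)) (isDigon-rev (rel D u v)))

  digonParity : List (Fin n × Fin n) → Parity
  digonParity ps = parity (countDigons D ps)

  digonParity-∷ : ∀ u v ps → digonParity ((u , v) ∷ ps) ≡ δ u v ℙ.+ digonParity ps
  digonParity-∷ u v ps with isDigon (rel D u v)
  ... | true  = ℙ.+-homo-+ 1 (countDigons D ps)
  ... | false = refl

  digonParity-++ : ∀ ps qs → digonParity (ps ++ qs) ≡ digonParity ps ℙ.+ digonParity qs
  digonParity-++ []             qs = refl
  digonParity-++ ((u , v) ∷ ps) qs = begin
    digonParity ((u , v) ∷ ps ++ qs)               ≡⟨ digonParity-∷ u v (ps ++ qs) ⟩
    δ u v ℙ.+ digonParity (ps ++ qs)               ≡⟨ cong (δ u v ℙ.+_) (digonParity-++ ps qs) ⟩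
    δ u v ℙ.+ (digonParity ps ℙ.+ digonParity qs)  ≡⟨ ℙ.+-assoc (δ u v) (digonParity ps) (digonParity qs) ⟨
    (δ u v ℙ.+ digonParity ps) ℙ.+ digonParity qs  ≡⟨ cong (ℙ._+ digonParity qs) (digonParity-∷ u v ps) ⟨
    digonParity ((u , v) ∷ ps) ℙ.+ digonParity qs  ∎
    where open ≡-Reasoning

  Balanced : List (Fin n × Fin n) → Set
  Balanced ps = All Edge ps → digonParity ps ≡ 0ℙ

  balanced-++ : ∀ ps qs rs → Balanced qs → Balanced (ps ++ rs) → Balanced (ps ++ qs ++ rs)
  balanced-++ ps qs rs qs-balanced ps++rs-balanced edges = begin
    digonParity (ps ++ qs ++ rs)                            ≡⟨ digonParity-++ ps (qs ++ rs) ⟩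
    digonParity ps ℙ.+ digonParity (qs ++ rs)               ≡⟨ cong (digonParity ps ℙ.+_) (digonParity-++ qs rs) ⟩
    digonParity ps ℙ.+ (digonParity qs ℙ.+ digonParity rs)  ≡⟨ cong (λ p → digonParity ps ℙ.+ (p ℙ.+ digonParity rs))
                                                                  (qs-balanced qs-edges) ⟩
    digonParity ps ℙ.+ digonParity rs                       ≡⟨ digonParity-++ ps rs ⟨
    digonParity (ps ++ rs)                                  ≡⟨ ps++rs-balanced (++⁺ ps-edges rs-edges) ⟩
    0ℙ                                                      ∎
    where
    open ≡-Reasoning
    ps-edges : All Edge ps
    ps-edges = proj₁ (++⁻ ps edges)
    qs-edges : All Edge qs
    qs-edges = proj₁ (++⁻ qs (proj₂ (++⁻ ps edges)))
    rs-edges : All Edge rs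
    rs-edges = proj₂ (++⁻ qs (proj₂ (++⁻ ps edges)))

  infixr 5 _◅_ _◅◅_

  data Walk : Fin n → Fin n → Parity → Set where
    ε   : ∀ {u} → Walk u u 0ℙ
    _◅_ : ∀ {u v w p} → Adjacent D u v → Walk v w p → Walk u w (δ u v ℙ.+ p)

  _◅◅_ : ∀ {u v w p q} → Walk u v p → Walk v w q → Walk u w (p ℙ.+ q)
  ε ◅◅ walk′ = walk′
  _◅◅_ {q = q} (_◅_ {u} {v} {p = p} uv walk) walk′ =
    subst (Walk _ _) (sym (ℙ.+-assoc (δ u v) p q)) (uv ◅ walk ◅◅ walk′)

  reverse : ∀ {u v p} → Walk u v p → Walk v u p
  reverse ε = ε
  reverse (_◅_ {u} {v} {p = p} uv walk) = subst (Walk _ _) parity≡ (reverse walk ◅◅ adjacent-sym uv ◅ ε)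
    where
    parity≡ : p ℙ.+ (δ v u ℙ.+ 0ℙ) ≡ δ u v ℙ.+ p
    parity≡ = trans (cong (p ℙ.+_) (trans (ℙ.+-identityʳ (δ v u)) (δ-sym u v))) (ℙ.+-comm p (δ u v))

  vertices : ∀ {u v p} → Walk u v p → List (Fin n)
  vertices ε                    = []
  vertices (_◅_ {v = v} _ walk) = v ∷ vertices walk

  walk-edges : ∀ {u v p} (walk : Walk u v p) → All Edge (steps (u ∷ vertices walk))
  walk-edges ε           = []
  walk-edges (uv ◅ walk) = uv ∷ walk-edges walk

  walk-parity : ∀ {u v p} (walk : Walk u v p) → digonParity (steps (u ∷ vertices walk)) ≡ p
  walk-parity ε                     = refl
  walk-parity (_◅_ {u} {v} uv walk) = trans (digonParity-∷ u v _) (cong (δ u v ℙ.+_) (walk-parity walk))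

  walk-ends : ∀ {u v p} (walk : Walk u v p) → ∃ λ l → u ∷ vertices walk ≡ l ++ [ v ]
  walk-ends ε               = [] , refl
  walk-ends {u} (uv ◅ walk) = let l , ends = walk-ends walk in u ∷ l , cong (u ∷_) ends

  Forest : Set
  Forest = ∀ x → Σ[ r ∈ Fin n ] Σ[ p ∈ Parity ] Walk r x p

  root : Forest → Fin n → Fin n
  root F x = proj₁ (F x)

  label : Forest → Fin n → Parity
  label F x = proj₁ (proj₂ (F x))

  path : ∀ F x → Walk (root F x) x (label F x)
  path F x = proj₂ (proj₂ (F x))

  graft : ∀ {u v} → Forest → Adjacent D u v → Forest
  graft {u} {v} F uv x with root F x ≟ root F v
  ... | yes x~v = root F u , _ ,
                  path F u ◅◅ uv ◅ reverse (path F v) ◅◅ subst (λ r → Walk r x (label F x)) x~v (path F x)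
  ... | no _    = F x

  graft-joins : ∀ {u v} F (uv : Adjacent D u v) → root (graft F uv) u ≡ root (graft F uv) v
  graft-joins {u} {v} F uv with root F u ≟ root F v | root F v ≟ root F v
  ... | _     | no v≁v = ⊥-elim (v≁v refl)
  ... | yes _ | yes _  = refl
  ... | no _  | yes _  = refl

  graft-preserves : ∀ {u v a b} F (uv : Adjacent D u v) →
                    root F a ≡ root F b → root (graft F uv) a ≡ root (graft F uv) b
  graft-preserves {v = v} {a} {b} F uv a~b with root F a ≟ root F v | root F b ≟ root F v
  ... | yes _   | yes _   = refl
  ... | yes a~v | no b≁v  = ⊥-elim (b≁v (trans (sym a~b) a~v))
  ... | no a≁v  | yes b~v = ⊥-elim (a≁v (trans a~b b~v))
  ... | no _    | no _    = a~b

  link : Fin n × Fin n → Forest → Forest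
  link (u , v) F with adjacent? u v
  ... | yes uv = graft F uv
  ... | no _   = F

  link-joins : ∀ {u v} F → Adjacent D u v → root (link (u , v) F) u ≡ root (link (u , v) F) v
  link-joins {u} {v} F uv with adjacent? u v
  ... | yes uv′ = graft-joins F uv′
  ... | no ¬uv  = ⊥-elim (¬uv uv)

  link-preserves : ∀ {a b} e F → root F a ≡ root F b → root (link e F) a ≡ root (link e F) b
  link-preserves (u , v) F a~b with adjacent? u v
  ... | yes uv = graft-preserves F uv a~b
  ... | no _   = a~b

  linkAll : List (Fin n × Fin n) → Forest → Forest
  linkAll []       F = F
  linkAll (e ∷ es) F = linkAll es (link e F)

  linkAll-preserves : ∀ {a b} es F → root F a ≡ root F b → root (linkAll es F) a ≡ root (linkAll es F) b
  linkAll-preserves []       F a~b = a~b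
  linkAll-preserves (e ∷ es) F a~b = linkAll-preserves es (link e F) (link-preserves e F a~b)

  linkAll-joins : ∀ {u v} es F → (u , v) ∈ es → Adjacent D u v → root (linkAll es F) u ≡ root (linkAll es F) v
  linkAll-joins (e ∷ es) F (here refl) uv = linkAll-preserves es (link e F) (link-joins F uv)
  linkAll-joins (e ∷ es) F (there uv∈) uv = linkAll-joins es (link e F) uv∈ uv

  spanningForest : Forest
  spanningForest = linkAll (cartesianProduct (allFin n) (allFin n)) (λ x → x , 0ℙ , ε)

  spanningForest-joins : ∀ {u v} → Adjacent D u v → root spanningForest u ≡ root spanningForest v
  spanningForest-joins {u} {v} = linkAll-joins _ _ (∈-cartesianProduct⁺ (∈-allFin u) (∈-allFin v))

  module _ (cycles-even : ∀ vs → IsCycle D vs → 2 ∣ digonsOnCycle D vs) where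

    simpleClosedSteps-balanced : ∀ x l → Unique (x ∷ l) → Balanced (closedSteps x l)
    simpleClosedSteps-balanced x []          _      (xx ∷ []) = ⊥-elim (xx (loopless D x))
    simpleClosedSteps-balanced x (y ∷ [])    _      _         = begin
      digonParity ((x , y) ∷ (y , x) ∷ [])  ≡⟨ digonParity-∷ x y ((y , x) ∷ []) ⟩
      δ x y ℙ.+ digonParity ((y , x) ∷ [])  ≡⟨ cong (δ x y ℙ.+_) (trans (digonParity-∷ y x []) (ℙ.+-identityʳ (δ y x))) ⟩
      δ x y ℙ.+ δ y x                       ≡⟨ cong (δ x y ℙ.+_) (δ-sym x y) ⟩
      δ x y ℙ.+ δ x y                       ≡⟨ ℙ.p+p≡0ℙ (δ x y) ⟩
      0ℙ                                    ∎
      where open ≡-Reasoning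
    simpleClosedSteps-balanced x (y ∷ z ∷ l) unique edges = begin
      digonParity (closedSteps x (y ∷ z ∷ l))   ≡⟨ cong digonParity (cycPairs≡closedSteps x (y ∷ z ∷ l)) ⟨
      parity (digonsOnCycle D (x ∷ y ∷ z ∷ l))  ≡⟨ parity-even (cycles-even (x ∷ y ∷ z ∷ l) cycle) ⟩
      0ℙ                                        ∎
      where
      open ≡-Reasoning
      cycle : IsCycle D (x ∷ y ∷ z ∷ l)
      cycle = unique , s≤s (s≤s (s≤s z≤n)) , subst (All Edge) (sym (cycPairs≡closedSteps x (y ∷ z ∷ l))) edges

    -- A repeated vertex y splits the closed walk into the loop at y and a shorter closed walk.
    closedSteps-balanced : ∀ x l → Acc _<_ (length (x ∷ l)) → Balanced (closedSteps x l)
    closedSteps-balanced x l (acc rec) with unique⊎repetition _≟_ (x ∷ l)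
    ... | inj₁ unique = simpleClosedSteps-balanced x l unique
    ... | inj₂ (a , y , b , c , x∷l≡) =
      subst Balanced (sym whole≡) (balanced-++ (steps (a ++ [ y ])) (closedSteps y b) (steps (y ∷ c ++ [ x ]))
        (closedSteps-balanced y b (rec loop<))
        (subst Balanced short≡ (closedSteps-balanced x l′ (rec short<))))
      where
      l′ : List (Fin n)
      l′ = proj₁ (shortcut a y b c x∷l≡)

      x∷l′≡ : x ∷ l′ ≡ a ++ y ∷ c
      x∷l′≡ = proj₂ (shortcut a y b c x∷l≡)

      whole≡ : closedSteps x l ≡ steps (a ++ [ y ]) ++ closedSteps y b ++ steps (y ∷ c ++ [ x ])
      whole≡ = trans (closedSteps-split a y (b ++ y ∷ c) x∷l≡) (cong (steps (a ++ [ y ]) ++_)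
        (trans (cong (λ z → steps (y ∷ z)) (++-assoc b (y ∷ c) [ x ])) (steps-++ (y ∷ b) y (c ++ [ x ]))))

      short≡ : closedSteps x l′ ≡ steps (a ++ [ y ]) ++ steps (y ∷ c ++ [ x ])
      short≡ = closedSteps-split a y c x∷l′≡

      loop< : length (y ∷ b) < length (x ∷ l)
      loop< = subst (length (y ∷ b) <_) (cong length (sym x∷l≡)) (loop-shorter a y b c)

      short< : length (x ∷ l′) < length (x ∷ l)
      short< = subst₂ _<_ (cong length (sym x∷l′≡)) (cong length (sym x∷l≡)) (shortcut-shorter a y b c)

    closedWalk-even : ∀ {u p} → Walk u u p → p ≡ 0ℙ
    closedWalk-even ε = refl
    closedWalk-even {u} {p} walk@(_ ◅ rest) = begin
      p                                        ≡⟨ walk-parity walk ⟨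
      digonParity (steps (u ∷ vertices walk))  ≡⟨ cong (digonParity ∘ steps) u∷vs≡ ⟩
      digonParity (closedSteps u l)            ≡⟨ closedSteps-balanced u l (<-wellFounded _) closed-edges ⟩
      0ℙ                                       ∎
      where
      open ≡-Reasoning
      l : List (Fin n)
      l = proj₁ (walk-ends rest)
      u∷vs≡ : u ∷ vertices walk ≡ u ∷ l ++ [ u ]
      u∷vs≡ = cong (u ∷_) (proj₂ (walk-ends rest))
      closed-edges : All Edge (closedSteps u l)
      closed-edges = subst (All Edge) (cong steps u∷vs≡) (walk-edges walk)

    -- The forest paths to u and v together with the edge uv form a closed walk.
    spanningForest-potential : ∀ u v → Adjacent D u v → δ u v ≡ label spanningForest u ℙ.+ label spanningForest v
    spanningForest-potential u v uv = x∙y⁻¹≈ε⇒x≈y (δ u v) (ℓ u ℙ.+ ℓ v)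
      (trans (Parity+.x∙yz≈y∙xz (δ u v) (ℓ u) (ℓ v)) (closedWalk-even closed))
      where
      ℓ : Fin n → Parity
      ℓ = label spanningForest
      closed : Walk (root spanningForest u) (root spanningForest u) (ℓ u ℙ.+ (δ u v ℙ.+ ℓ v))
      closed = subst (λ r → Walk (root spanningForest u) r (ℓ u ℙ.+ (δ u v ℙ.+ ℓ v))) (sym (spanningForest-joins uv))
        (path spanningForest u ◅◅ uv ◅ reverse (path spanningForest v))

    switching : Bipartite D → ∃ λ (s : Fin n → Parity) → ∀ u v → Adjacent D u v → s u ℙ.+ s v ≡ 1ℙ ℙ.+ δ u v
    switching (colour , proper) = s , s-arcs
      where
      ℓ : Fin n → Parity
      ℓ = label spanningForest

      s : Fin n → Parity
      s x = ℓ x ℙ.+ bit (colour x)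

      s-arcs : ∀ u v → Adjacent D u v → s u ℙ.+ s v ≡ 1ℙ ℙ.+ δ u v
      s-arcs u v uv = begin
        (ℓ u ℙ.+ bit (colour u)) ℙ.+ (ℓ v ℙ.+ bit (colour v))  ≡⟨ Parity+.interchange (ℓ u) _ (ℓ v) _ ⟩
        (ℓ u ℙ.+ ℓ v) ℙ.+ (bit (colour u) ℙ.+ bit (colour v))  ≡⟨ cong₂ ℙ._+_ (sym (spanningForest-potential u v uv))
                                                                         (bit-≢ (proper u v uv)) ⟩
        δ u v ℙ.+ 1ℙ                                           ≡⟨ ℙ.+-comm (δ u v) 1ℙ ⟩
        1ℙ ℙ.+ δ u v                                           ∎
        where open ≡-Reasoning

-- ω̄ = −γ and ω = −γ̄: on arcs the two Hermitian adjacency matrices differ by transposition and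
-- a sign, on digons only by transposition.
entry-ω≡±entry-γ : ∀ r p → (r ≢ none → p ≡ 1ℙ ℙ.+ bit (isDigon r)) → entry ωc r ≡ sign p *w entry γc (rev r)
entry-ω≡±entry-γ none  0ℙ _   = refl
entry-ω≡±entry-γ none  1ℙ _   = refl
entry-ω≡±entry-γ digon p  arc rewrite arc (λ ()) = refl
entry-ω≡±entry-γ out   p  arc rewrite arc (λ ()) = refl
entry-ω≡±entry-γ inn   p  arc rewrite arc (λ ()) = refl

corollary4p9 : ∀ {n} (D : MixedGraph n) → Bipartite D
    → (∀ (vs : List (Fin n)) → IsCycle D vs → 2 ∣ digonsOnCycle D vs)
    → SameSpectrum (H γc D) (H ωc D)
corollary4p9 D bipartite cycles-even with SignedGraph.switching D cycles-even bipartite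
... | s , s-arcs = ≋⇒≈P _ _ (charPoly-signedTranspose s (H γc D) (H ωc D) Hω≡±Hγᵀ)
  where
  Hω≡±Hγᵀ : ∀ i j → H ωc D i j ≡ sign (s i ℙ.+ s j) *w H γc D j i
  Hω≡±Hγᵀ i j = trans (entry-ω≡±entry-γ (rel D i j) (s i ℙ.+ s j) (s-arcs i j))
                      (cong (λ r → sign (s i ℙ.+ s j) *w entry γc r) (sym (consistent D i j)))
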